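{- Let $L$ be a finite atomic lattice with $n$ atoms. If for every bijection $\gamma:\mathcal{A}(L)\to[n]$ the minimal labeling $\lambda_\gamma$ is an $EL$-labeling of $L$, then $L$ is a geometric lattice.
   Context: For a finite poset $P$, $E(P)$ denotes the set of edges (cover relations $x\lessdot y$) of its Hasse diagram. An edge labeling $\lambda:E(P)\to\mathbb{N}$ is an $EL$-labeling if for every interval $[x,y]$ of $P$ there is a unique saturated chain $x=x_1\lessdot x_2\lessdot\cdots\lessdot x_j=y$ whose labels are weakly increasing, $\lambda(x_1,x_2)\le\lambda(x_2,x_3)\le\cdots\le\lambda(x_{j-1},x_j)$, and its label sequence is lexicographically smaller than the label sequence of every other saturated chain in $[x,y]$. An atom of a lattice with minimum $\hat 0$ is an element covering $\hat 0$; $\mathcal{A}(L)$ denotes the set of atoms of $L$. A lattice is atomic if every element is a join of atoms. A finite lattice is geometric if it is atomic and semimodular, where semimodular means it is graded with rank function $\rho$ satisfying $\rho(x\wedge y)+\rho(x\vee y)\le\rho(x)+\rho(y)$ for all $x,y$. For $x\in L$ let $A(x)=\{a\in\mathcal{A}(L): a\le x\}$. For a bijection $\gamma:\mathcal{A}(L)\to[n]=\{1,\dots,n\}$, the minimal labeling $\lambda_\gamma:E(L)\to[n]$ is defined by $\lambda_\gamma(x,y)=\min\bigl(\gamma(A(y))\setminus\gamma(A(x))\bigr)$ for each cover relation $x\lessdot y$. -}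

module Defs where

open import Level using (0ℓ)
open import Data.Nat using (ℕ; suc; _+_; _≤_; _<_)
open import Data.Fin using (Fin)
open import Data.List using (List; []; _∷_)
open import Data.Product using (Σ; Σ-syntax; _×_)
open import Relation.Nullary using (¬_)
open import Relation.Unary using (Pred)
open import Relation.Binary.Core using (Rel)
open import Relation.Binary.Definitions using (Decidable)
open import Relation.Binary.PropositionalEquality using (_≡_; _≢_)
open import Relation.Binary.Lattice using (IsLattice)
open import Algebra.Core using (Op₂)
open import Data.List.Relation.Unary.Linked using (Linked)
open import Data.List.Relation.Binary.Lex.Strict using (Lex-<)

-- A finite lattice: carrier Fin size, a partial order _⊑_ (w.r.t. _≡_)
-- with binary joins _∨_ and meets _∧_.  The order is assumed decidable
-- (automatic classically for a finite lattice).

record FiniteLattice : Set₁ where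
  field
    size      : ℕ
    _⊑_       : Rel (Fin size) 0ℓ
    _∨_       : Op₂ (Fin size)
    _∧_       : Op₂ (Fin size)
    isLattice : IsLattice _≡_ _⊑_ _∨_ _∧_
    _⊑?_      : Decidable _⊑_

module _ (L : FiniteLattice) where
  open FiniteLattice L

  Elem : Set
  Elem = Fin size

  _⊏_ : Elem → Elem → Set
  x ⊏ y = x ⊑ y × x ≢ y

  _⋖_ : Elem → Elem → Set
  x ⋖ y = x ⊏ y × (∀ z → x ⊏ z → ¬ (z ⊏ y))

  IsBottom : Elem → Set
  IsBottom z = ∀ x → z ⊑ x

  IsAtom : Elem → Set
  IsAtom a = Σ[ z ∈ Elem ] (IsBottom z × z ⋖ a)

  IsJoinOf : Pred Elem 0ℓ → Elem → Set
  IsJoinOf S x = (∀ a → S a → a ⊑ x) × (∀ u → (∀ a → S a → a ⊑ u) → x ⊑ u)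

  IsAtomic : Set₁
  IsAtomic = ∀ x → Σ[ S ∈ Pred Elem 0ℓ ] ((∀ a → S a → IsAtom a) × IsJoinOf S x)

  IsRankFunction : (Elem → ℕ) → Set
  IsRankFunction ρ = (∀ z → IsBottom z → ρ z ≡ 0) × (∀ x y → x ⋖ y → ρ y ≡ suc (ρ x))

  IsSemimodular : Set
  IsSemimodular = Σ[ ρ ∈ (Elem → ℕ) ]
    (IsRankFunction ρ × (∀ x y → ρ (x ∧ y) + ρ (x ∨ y) ≤ ρ x + ρ y))

  IsGeometric : Set₁
  IsGeometric = IsAtomic × IsSemimodular

  -- γ : Elem → ℕ restricts to a bijection from the atoms onto [n] = {1,…,n}
  -- (values of γ on non-atoms are irrelevant)
  IsAtomBijection : ℕ → (Elem → ℕ) → Set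
  IsAtomBijection n γ =
      (∀ a → IsAtom a → 1 ≤ γ a × γ a ≤ n)
    × (∀ a b → IsAtom a → IsAtom b → γ a ≡ γ b → a ≡ b)
    × (∀ i → 1 ≤ i → i ≤ n → Σ[ a ∈ Elem ] (IsAtom a × γ a ≡ i))

  HasAtomCount : ℕ → Set
  HasAtomCount n = Σ[ γ ∈ (Elem → ℕ) ] IsAtomBijection n γ

  InImageOfAtomsBelow : (Elem → ℕ) → Elem → ℕ → Set
  InImageOfAtomsBelow γ x ℓ = Σ[ a ∈ Elem ] (IsAtom a × a ⊑ x × γ a ≡ ℓ)

  InLabelSet : (Elem → ℕ) → Elem → Elem → ℕ → Set
  InLabelSet γ x y ℓ = InImageOfAtomsBelow γ y ℓ × ¬ InImageOfAtomsBelow γ x ℓ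

  -- edge labelings are represented as functions Elem → Elem → ℕ; only
  -- their values on cover relations matter.
  -- λ is the minimal labeling λ_γ:  λ(x,y) = min (γ(A(y)) \ γ(A(x))) on edges
  IsMinimalLabeling : (Elem → ℕ) → (Elem → Elem → ℕ) → Set
  IsMinimalLabeling γ lab = ∀ x y → x ⋖ y →
    InLabelSet γ x y (lab x y) × (∀ ℓ → InLabelSet γ x y ℓ → lab x y ≤ ℓ)

  data SatChain : Elem → Elem → List Elem → Set where
    single : ∀ x → SatChain x x (x ∷ [])
    cons   : ∀ {x z y c} → x ⋖ z → SatChain z y c → SatChain x y (x ∷ c)

  labels : (Elem → Elem → ℕ) → List Elem → List ℕ
  labels lab (x ∷ z ∷ c) = lab x z ∷ labels lab (z ∷ c)
  labels lab _           = []

  IsELLabeling : (Elem → Elem → ℕ) → Set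
  IsELLabeling lab = ∀ x y → x ⊑ y → Σ[ c ∈ List Elem ]
      ( SatChain x y c
      × Linked _≤_ (labels lab c)
      × (∀ c′ → SatChain x y c′ → Linked _≤_ (labels lab c′) → c′ ≡ c)
      × (∀ c′ → SatChain x y c′ → c′ ≢ c → Lex-< _≡_ _<_ (labels lab c) (labels lab c′)))

-- Giving an atom p the smallest label 1 forces the increasing chain from x to x ∨ p (for p ⋢ x)
-- to be a single edge: its last label is at most 1, hence so is its first, so already its first
-- step contains p and reaches x ∨ p. Thus x ⋖ x ∨ p whenever p ⋢ x, the atom covering property.
-- For an atomic lattice this gives the diamond property c ⋖ a, c ⋖ b ⇒ a ⋖ a ∨ b, hence the
-- Jordan–Dedekind chain condition and a rank function; joining a maximal chain from x ∧ y to x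
-- with y yields a chain from y to x ∨ y that is no longer, which is the submodular inequality.
module Submission where

open import Level using (0ℓ)
open import Data.Nat using (ℕ; zero; suc; _+_; _≤_; z≤n; s≤s; s≤s⁻¹)
open import Data.Nat.Properties
  using (≤-refl; ≤-trans; ≤-antisym; ≰⇒>; m≤n⇒m<n∨m≡n; m≤n⇒m≤1+n; +-comm; +-assoc; +-monoʳ-≤; module ≤-Reasoning)
  renaming (_≟_ to _≟ℕ_)
open import Data.Fin using () renaming (_≟_ to _≟Fin_)
open import Data.Fin.Properties using (any?; all?)
open import Data.List using (List; []; _∷_; foldr; allFin)
open import Data.List.Relation.Unary.Any using (here; there)
open import Data.List.Relation.Unary.Linked using (Linked; _∷_)
open import Data.List.Membership.Propositional using (_∈_)
open import Data.List.Membership.Propositional.Properties using (∈-allFin)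
open import Data.Product using (Σ-syntax; ∃; ∃-syntax; _×_; _,_; proj₁; proj₂)
open import Data.Sum using (_⊎_; inj₁; inj₂; [_,_]′)
open import Data.Empty using (⊥-elim)
open import Function using (_∘_)
open import Relation.Nullary using (¬_; Dec; yes; no)
open import Relation.Nullary.Decidable using (_×-dec_; _→-dec_; ¬?; decidable-stable)
open import Relation.Unary using (Pred)
import Relation.Unary as U
open import Relation.Binary.Definitions using (Decidable)
open import Relation.Binary.PropositionalEquality
  using (_≡_; _≢_; refl; sym; trans; cong; subst; module ≡-Reasoning)
open import Relation.Binary.Lattice using (Lattice; IsLattice)
import Relation.Binary.Lattice.Properties.JoinSemilattice as JoinSemilatticeProperties

open import Defs
  using (FiniteLattice; IsAtomic; IsSemimodular; IsGeometric; IsAtomBijection; HasAtomCount;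
         InLabelSet; IsMinimalLabeling; IsELLabeling; single; cons)
import Defs as D

least-or-none : {P : Pred ℕ 0ℓ} → U.Decidable P → ∀ N →
  (∃[ l ] P l × (∀ j → P j → l ≤ j)) ⊎ (∀ j → j ≤ N → ¬ P j)
least-or-none P? zero with P? 0
... | yes P0 = inj₁ (0 , P0 , λ _ _ → z≤n)
... | no ¬P0 = inj₂ λ { _ z≤n → ¬P0 }
least-or-none P? (suc N) with least-or-none P? N
... | inj₁ least = inj₁ least
... | inj₂ none with P? (suc N)
...   | yes P1+N = inj₁ (suc N , P1+N , λ j Pj → ≰⇒> λ j≤N → none j j≤N Pj)
...   | no ¬P1+N = inj₂ λ j j≤1+N →
  [ (λ j<1+N → none j (s≤s⁻¹ j<1+N)) , (λ { refl → ¬P1+N }) ]′ (m≤n⇒m<n∨m≡n j≤1+N)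

transpose : ℕ → ℕ → ℕ → ℕ
transpose i j v with v ≟ℕ i | v ≟ℕ j
... | yes _ | _     = j
... | no _  | yes _ = i
... | no _  | no _  = v

transpose-i : ∀ i j → transpose i j i ≡ j
transpose-i i j with i ≟ℕ i
... | yes _   = refl
... | no i≢i  = ⊥-elim (i≢i refl)

transpose-j : ∀ i j → transpose i j j ≡ i
transpose-j i j with j ≟ℕ i | j ≟ℕ j
... | yes j≡i | _       = j≡i
... | no _    | yes _   = refl
... | no _    | no j≢j  = ⊥-elim (j≢j refl)

transpose-other : ∀ {i j v} → v ≢ i → v ≢ j → transpose i j v ≡ v
transpose-other {i} {j} {v} v≢i v≢j with v ≟ℕ i | v ≟ℕ j
... | yes v≡i | _       = ⊥-elim (v≢i v≡i)
... | no _    | yes v≡j = ⊥-elim (v≢j v≡j)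
... | no _    | no _    = refl

transpose-involutive : ∀ i j v → transpose i j (transpose i j v) ≡ v
transpose-involutive i j v with v ≟ℕ i | v ≟ℕ j
... | yes refl | _        = transpose-j i j
... | no _     | yes refl = transpose-i i j
... | no v≢i   | no v≢j   = transpose-other v≢i v≢j

transpose-injective : ∀ i j {u v} → transpose i j u ≡ transpose i j v → u ≡ v
transpose-injective i j {u} {v} e = begin
  u                                   ≡⟨ sym (transpose-involutive i j u) ⟩
  transpose i j (transpose i j u)     ≡⟨ cong (transpose i j) e ⟩
  transpose i j (transpose i j v)     ≡⟨ transpose-involutive i j v ⟩
  v                                   ∎
  where open ≡-Reasoning

transpose-preserves : ∀ {p} (P : Pred ℕ p) {i j v} → P i → P j → P v → P (transpose i j v)
transpose-preserves P {i} {j} {v} Pi Pj Pv with v ≟ℕ i | v ≟ℕ j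
... | yes _ | _     = Pj
... | no _  | yes _ = Pi
... | no _  | no _  = Pv

module _ (L : FiniteLattice) where
  open FiniteLattice L
  open IsLattice isLattice
    using (antisym; x≤x∨y; y≤x∨y; ∨-least; x∧y≤x; x∧y≤y) renaming (refl to ⊑-refl; trans to ⊑-trans)

  private
    lattice : Lattice 0ℓ 0ℓ 0ℓ
    lattice = record { _≈_ = _≡_ ; _≤_ = _⊑_ ; _∨_ = _∨_ ; _∧_ = _∧_ ; isLattice = isLattice }

  open JoinSemilatticeProperties (Lattice.joinSemilattice lattice) using (∨-comm; ∨-assoc; x≤y⇒x∨y≈y)

  Elem : Set
  Elem = D.Elem L

  infix 4 _⊏_ _⋖_

  _⊏_ : Elem → Elem → Set
  _⊏_ = D._⊏_ L

  _⋖_ : Elem → Elem → Set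
  _⋖_ = D._⋖_ L

  IsAtom : Elem → Set
  IsAtom = D.IsAtom L

  ⊏? : Decidable _⊏_
  ⊏? x y = (x ⊑? y) ×-dec ¬? (x ≟Fin y)

  ⋖? : Decidable _⋖_
  ⋖? x y = ⊏? x y ×-dec all? (λ z → ⊏? x z →-dec ¬? (⊏? z y))

  isAtom? : U.Decidable IsAtom
  isAtom? a = any? (λ z → all? (λ x → z ⊑? x) ×-dec ⋖? z a)

  ⋖-asym : ∀ {x y} → x ⋖ y → ¬ y ⊑ x
  ⋖-asym ((x⊑y , x≢y) , _) y⊑x = x≢y (antisym x⊑y y⊑x)

  ⋖-squeeze : ∀ {c b w} → c ⋖ b → c ⊑ w → w ⊑ b → w ≢ c → w ≡ b
  ⋖-squeeze {b = b} {w} (_ , nothing-between) c⊑w w⊑b w≢c with w ≟Fin b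
  ... | yes w≡b = w≡b
  ... | no w≢b  = ⊥-elim (nothing-between w (c⊑w , w≢c ∘ sym) (w⊑b , w≢b))

  y⊑x⇒x∨y≡x : ∀ {p z} → p ⊑ z → z ∨ p ≡ z
  y⊑x⇒x∨y≡x {p} {z} p⊑z = trans (∨-comm z p) (x≤y⇒x∨y≈y p⊑z)

  ∨-rotate : ∀ x y p → (x ∨ y) ∨ p ≡ (x ∨ p) ∨ y
  ∨-rotate x y p = begin
    (x ∨ y) ∨ p   ≡⟨ ∨-assoc x y p ⟩
    x ∨ (y ∨ p)   ≡⟨ cong (x ∨_) (∨-comm y p) ⟩
    x ∨ (p ∨ y)   ≡⟨ sym (∨-assoc x p y) ⟩
    (x ∨ p) ∨ y   ∎
    where open ≡-Reasoning

  ∨-new-element : ∀ {c b p} → c ⋖ b → p ⊑ b → ¬ p ⊑ c → c ∨ p ≡ b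
  ∨-new-element {c} {b} {p} c⋖b p⊑b p⋢c =
    ⋖-squeeze c⋖b (x≤x∨y c p) (∨-least (proj₁ (proj₁ c⋖b)) p⊑b) λ c∨p≡c → p⋢c (subst (p ⊑_) c∨p≡c (y≤x∨y c p))

  satChain⇒⊑ : ∀ {x y c} → D.SatChain L x y c → x ⊑ y
  satChain⇒⊑ (single _)   = ⊑-refl
  satChain⇒⊑ (cons x⋖z c) = ⊑-trans (proj₁ (proj₁ x⋖z)) (satChain⇒⊑ c)

  infixr 5 _◅_ _◅◅_

  data Chain : Elem → Elem → ℕ → Set where
    ε   : ∀ {x} → Chain x x 0
    _◅_ : ∀ {x z y k} → x ⋖ z → Chain z y k → Chain x y (suc k)

  _◅◅_ : ∀ {x y z k m} → Chain x y k → Chain y z m → Chain x z (k + m)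
  ε         ◅◅ d = d
  (s ◅ c)   ◅◅ d = s ◅ (c ◅◅ d)

  chain⇒⊑ : ∀ {x y k} → Chain x y k → x ⊑ y
  chain⇒⊑ ε         = ⊑-refl
  chain⇒⊑ (x⋖z ◅ c) = ⊑-trans (proj₁ (proj₁ x⋖z)) (chain⇒⊑ c)

  -- Elem may be empty, so the meet of all elements needs a seed.
  bottom : Elem → Elem
  bottom s = foldr _∧_ s (allFin size)

  foldr-∧-lower : ∀ s xs {y} → y ∈ xs → foldr _∧_ s xs ⊑ y
  foldr-∧-lower s (x ∷ xs) (here refl) = x∧y≤x x (foldr _∧_ s xs)
  foldr-∧-lower s (x ∷ xs) (there y∈xs) = ⊑-trans (x∧y≤y x (foldr _∧_ s xs)) (foldr-∧-lower s xs y∈xs)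

  bottom-least : ∀ s y → bottom s ⊑ y
  bottom-least s y = foldr-∧-lower s (allFin size) (∈-allFin y)

  bottom-unique : ∀ s t → bottom s ≡ bottom t
  bottom-unique s t = antisym (bottom-least s (bottom t)) (bottom-least t (bottom s))

  AtomCovering : Set
  AtomCovering = ∀ {p x} → IsAtom p → ¬ p ⊑ x → x ⋖ x ∨ p

  module _ (atomic : IsAtomic L) where

    ⊑-by-atoms : ∀ {x y} → (∀ a → IsAtom a → a ⊑ y → a ⊑ x) → y ⊑ x
    ⊑-by-atoms {x} {y} below with atomic y
    ... | S , S-atoms , S⊑y , y-least = y-least x λ a a∈S → below a (S-atoms a a∈S) (S⊑y a a∈S)

    ⋢⇒new-atom : ∀ {x y} → ¬ y ⊑ x → Σ[ a ∈ Elem ] (IsAtom a × a ⊑ y × ¬ a ⊑ x)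
    ⋢⇒new-atom {x} {y} y⋢x with any? (λ a → isAtom? a ×-dec (a ⊑? y) ×-dec ¬? (a ⊑? x))
    ... | yes new = new
    ... | no none = ⊥-elim (y⋢x (⊑-by-atoms λ a a-atom a⊑y →
                      decidable-stable (a ⊑? x) λ a⋢x → none (a , a-atom , a⊑y , a⋢x)))

    module _ (covering : AtomCovering) where

      diamond : ∀ {c a b} → c ⋖ a → c ⋖ b → a ≢ b → a ⋖ a ∨ b
      diamond {c} {a} {b} c⋖a c⋖b a≢b with ⋢⇒new-atom (⋖-asym c⋖b)
      ... | p , p-atom , p⊑b , p⋢c = subst (a ⋖_) a∨p≡a∨b (covering p-atom p⋢a)
        where
        c∨p≡b : c ∨ p ≡ b
        c∨p≡b = ∨-new-element c⋖b p⊑b p⋢c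
        p⋢a : ¬ p ⊑ a
        p⋢a p⊑a = a≢b (trans (sym (∨-new-element c⋖a p⊑a p⋢c)) c∨p≡b)
        a∨p≡a∨b : a ∨ p ≡ a ∨ b
        a∨p≡a∨b = begin
          a ∨ p         ≡⟨ cong (_∨ p) (sym (y⊑x⇒x∨y≡x (proj₁ (proj₁ c⋖a)))) ⟩
          (a ∨ c) ∨ p   ≡⟨ ∨-assoc a c p ⟩
          a ∨ (c ∨ p)   ≡⟨ cong (a ∨_) c∨p≡b ⟩
          a ∨ b         ∎
          where open ≡-Reasoning

      ∨-preserves-⋖ : ∀ {x x′} → x ⋖ x′ → ∀ y → x ∨ y ≡ x′ ∨ y ⊎ x ∨ y ⋖ x′ ∨ y
      ∨-preserves-⋖ {x} {x′} x⋖x′ y with ⋢⇒new-atom (⋖-asym x⋖x′)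
      ... | p , p-atom , p⊑x′ , p⋢x = absorbed-or-covered (p ⊑? (x ∨ y))
        where
        x∨y∨p≡x′∨y : (x ∨ y) ∨ p ≡ x′ ∨ y
        x∨y∨p≡x′∨y = trans (∨-rotate x y p) (cong (_∨ y) (∨-new-element x⋖x′ p⊑x′ p⋢x))
        absorbed-or-covered : Dec (p ⊑ (x ∨ y)) → x ∨ y ≡ x′ ∨ y ⊎ x ∨ y ⋖ x′ ∨ y
        absorbed-or-covered (yes p⊑x∨y) = inj₁ (trans (sym (y⊑x⇒x∨y≡x p⊑x∨y)) x∨y∨p≡x′∨y)
        absorbed-or-covered (no p⋢x∨y)  = inj₂ (subst (x ∨ y ⋖_) x∨y∨p≡x′∨y (covering p-atom p⋢x∨y))

      RemainingAtomsIn : List Elem → Elem → Elem → Set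
      RemainingAtomsIn as x y = ∀ a → IsAtom a → a ⊑ y → a ∈ as ⊎ a ⊑ x

      remove-atom : ∀ {a as x x′ y} → x ⊑ x′ → (IsAtom a → a ⊑ y → a ⊑ x′) →
                    RemainingAtomsIn (a ∷ as) x y → RemainingAtomsIn as x′ y
      remove-atom x⊑x′ a⊑x′ remaining q q-atom q⊑y with remaining q q-atom q⊑y
      ... | inj₁ (here refl)   = inj₂ (a⊑x′ q-atom q⊑y)
      ... | inj₁ (there q∈as) = inj₁ q∈as
      ... | inj₂ q⊑x          = inj₂ (⊑-trans q⊑x x⊑x′)

      chain-by-adjoining : ∀ {x y} as → x ⊑ y → RemainingAtomsIn as x y → ∃ (Chain x y)
      chain-by-adjoining {x} {y} [] x⊑y remaining = 0 , subst (λ t → Chain x t 0) x≡y ε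
        where
        x≡y : x ≡ y
        x≡y = antisym x⊑y (⊑-by-atoms λ a a-atom a⊑y → [ (λ ()) , (λ a⊑x → a⊑x) ]′ (remaining a a-atom a⊑y))
      chain-by-adjoining {x} {y} (a ∷ as) x⊑y remaining
        with isAtom? a ×-dec (a ⊑? y) ×-dec ¬? (a ⊑? x)
      ... | yes (a-atom , a⊑y , a⋢x) =
        let k , c = chain-by-adjoining as (∨-least x⊑y a⊑y)
                      (remove-atom (x≤x∨y x a) (λ _ _ → y≤x∨y x a) remaining)
        in suc k , covering a-atom a⋢x ◅ c
      ... | no not-new = chain-by-adjoining as x⊑y (remove-atom ⊑-refl (λ a-atom a⊑y →
              decidable-stable (a ⊑? x) λ a⋢x → not-new (a-atom , a⊑y , a⋢x)) remaining)

      chain-exists : ∀ {x y} → x ⊑ y → ∃ (Chain x y)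
      chain-exists x⊑y = chain-by-adjoining (allFin size) x⊑y λ a _ _ → inj₁ (∈-allFin a)

      jordan-dedekind : ∀ k {x y m} → Chain x y k → Chain x y m → k ≡ m
      jordan-dedekind zero    ε         ε         = refl
      jordan-dedekind zero    ε         (x⋖z ◅ c) = ⊥-elim (⋖-asym x⋖z (chain⇒⊑ c))
      jordan-dedekind (suc k) (x⋖z ◅ c) ε         = ⊥-elim (⋖-asym x⋖z (chain⇒⊑ c))
      jordan-dedekind (suc k) (_◅_ {z = a} x⋖a ca) (_◅_ {z = b} x⋖b cb) with a ≟Fin b
      ... | yes refl = cong suc (jordan-dedekind k ca cb)
      ... | no a≢b with chain-exists (∨-least (chain⇒⊑ ca) (chain⇒⊑ cb))
      ...   | r , c = cong suc (jordan-dedekind k (subst (Chain b _) (sym k≡1+r) (b⋖a∨b ◅ c)) cb)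
        where
        k≡1+r : k ≡ suc r
        k≡1+r = jordan-dedekind k ca (diamond x⋖a x⋖b a≢b ◅ c)
        b⋖a∨b : b ⋖ a ∨ b
        b⋖a∨b = subst (b ⋖_) (∨-comm b a) (diamond x⋖b x⋖a (a≢b ∘ sym))

      rank : Elem → ℕ
      rank x = proj₁ (chain-exists (bottom-least x x))

      rank-chain : ∀ x → Chain (bottom x) x (rank x)
      rank-chain x = proj₂ (chain-exists (bottom-least x x))

      rank-chain-length : ∀ {x y k} → Chain x y k → rank x + k ≡ rank y
      rank-chain-length {x} {y} {k} c = jordan-dedekind (rank x + k)
        (subst (λ b → Chain b y (rank x + k)) (bottom-unique x y) (rank-chain x ◅◅ c)) (rank-chain y)

      rank-bottom : ∀ z → D.IsBottom L z → rank z ≡ 0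
      rank-bottom z z-bottom = jordan-dedekind (rank z)
        (subst (λ b → Chain b z (rank z)) (antisym (bottom-least z z) (z-bottom (bottom z))) (rank-chain z)) ε

      rank-⋖ : ∀ {x y} → x ⋖ y → rank y ≡ suc (rank x)
      rank-⋖ {x} x⋖y = trans (sym (rank-chain-length (x⋖y ◅ ε))) (+-comm (rank x) 1)

      ∨-chain : ∀ y {x x′ k} → Chain x x′ k → ∃[ r ] r ≤ k × Chain (x ∨ y) (x′ ∨ y) r
      ∨-chain y ε = 0 , z≤n , ε
      ∨-chain y {x′ = x′} (x⋖z ◅ c) with ∨-chain y c | ∨-preserves-⋖ x⋖z y
      ... | r , r≤k , c′ | inj₁ x∨y≡z∨y = r , m≤n⇒m≤1+n r≤k , subst (λ t → Chain t (x′ ∨ y) r) (sym x∨y≡z∨y) c′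
      ... | r , r≤k , c′ | inj₂ x∨y⋖z∨y = suc r , s≤s r≤k , x∨y⋖z∨y ◅ c′

      rank-submodular : ∀ x y → rank (x ∧ y) + rank (x ∨ y) ≤ rank x + rank y
      rank-submodular x y with chain-exists (x∧y≤x x y)
      ... | k , c with ∨-chain y c
      ...   | r , r≤k , c′ = begin
          rank (x ∧ y) + rank (x ∨ y)   ≡⟨ cong (rank (x ∧ y) +_) (sym (rank-chain-length c″)) ⟩
          rank (x ∧ y) + (rank y + r)   ≤⟨ +-monoʳ-≤ (rank (x ∧ y)) (+-monoʳ-≤ (rank y) r≤k) ⟩
          rank (x ∧ y) + (rank y + k)   ≡⟨ cong (rank (x ∧ y) +_) (+-comm (rank y) k) ⟩
          rank (x ∧ y) + (k + rank y)   ≡⟨ sym (+-assoc (rank (x ∧ y)) k (rank y)) ⟩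
          (rank (x ∧ y) + k) + rank y   ≡⟨ cong (_+ rank y) (rank-chain-length c) ⟩
          rank x + rank y               ∎
        where
        open ≤-Reasoning
        c″ : Chain y (x ∨ y) r
        c″ = subst (λ t → Chain t (x ∨ y) r) (x≤y⇒x∨y≈y (x∧y≤y x y)) c′

      atomic-covering⇒semimodular : IsSemimodular L
      atomic-covering⇒semimodular = rank , (rank-bottom , λ _ _ → rank-⋖) , rank-submodular

  first-label-bounded : ∀ lab {b x z y c} → (∀ u → x ⊑ u → u ⋖ y → lab u y ≤ b) →
    x ⋖ z → D.SatChain L z y c → Linked _≤_ (D.labels L lab (x ∷ c)) → lab x z ≤ b
  first-label-bounded lab last≤b x⋖z (single _) _ = last≤b _ ⊑-refl x⋖z
  -- The two remaining clauses agree; splitting c is what lets labels (x ∷ z ∷ c) compute.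
  first-label-bounded lab last≤b x⋖z (cons z⋖z′ c@(single _)) (x≤z ∷ increasing) =
    ≤-trans x≤z (first-label-bounded lab (λ u z⊑u → last≤b u (⊑-trans (proj₁ (proj₁ x⋖z)) z⊑u)) z⋖z′ c increasing)
  first-label-bounded lab last≤b x⋖z (cons z⋖z′ c@(cons _ _)) (x≤z ∷ increasing) =
    ≤-trans x≤z (first-label-bounded lab (λ u z⊑u → last≤b u (⊑-trans (proj₁ (proj₁ x⋖z)) z⊑u)) z⋖z′ c increasing)

  module _ {n γ} (bij : IsAtomBijection L n γ) where
    private
      γ-bounds : ∀ a → IsAtom a → 1 ≤ γ a × γ a ≤ n
      γ-bounds = proj₁ bij
      γ-injective : ∀ a b → IsAtom a → IsAtom b → γ a ≡ γ b → a ≡ b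
      γ-injective = proj₁ (proj₂ bij)

    inLabelSet? : ∀ x y ℓ → Dec (InLabelSet L γ x y ℓ)
    inLabelSet? x y ℓ = inImage? y ×-dec ¬? (inImage? x)
      where
      inImage? : ∀ w → Dec (D.InImageOfAtomsBelow L γ w ℓ)
      inImage? w = any? λ a → isAtom? a ×-dec (a ⊑? w) ×-dec (γ a ≟ℕ ℓ)

    atom-inLabelSet : ∀ {x y a} → IsAtom a → a ⊑ y → ¬ a ⊑ x → InLabelSet L γ x y (γ a)
    atom-inLabelSet {x} {a = a} a-atom a⊑y a⋢x = (a , a-atom , a⊑y , refl) ,
      λ { (b , b-atom , b⊑x , γb≡γa) → a⋢x (subst (_⊑ x) (γ-injective b a b-atom a-atom γb≡γa) b⊑x) }

    -- Off the edges the label set may be empty; the value 0 there is junk.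
    minimalLabeling : Elem → Elem → ℕ
    minimalLabeling x y with least-or-none (inLabelSet? x y) n
    ... | inj₁ (ℓ , _) = ℓ
    ... | inj₂ _       = 0

    minimalLabeling-isMinimal : IsAtomic L → IsMinimalLabeling L γ minimalLabeling
    minimalLabeling-isMinimal atomic x y x⋖y with least-or-none (inLabelSet? x y) n
    ... | inj₁ (_ , ℓ-in , ℓ-least) = ℓ-in , ℓ-least
    ... | inj₂ none with ⋢⇒new-atom atomic (⋖-asym x⋖y)
    ...   | a , a-atom , a⊑y , a⋢x = ⊥-elim (none (γ a) (proj₂ (γ-bounds a a-atom)) (atom-inLabelSet a-atom a⊑y a⋢x))

    increasing-chain⇒⋖ : ∀ {p lab x y c} → IsAtom p → γ p ≡ 1 → IsMinimalLabeling L γ lab →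
      ¬ p ⊑ x → x ∨ p ≡ y → D.SatChain L x y c → Linked _≤_ (D.labels L lab c) → x ⋖ y
    increasing-chain⇒⋖ {p} p-atom γp≡1 minimal p⋢x x∨p≡y (single _) _ =
      ⊥-elim (p⋢x (subst (p ⊑_) x∨p≡y (y≤x∨y _ p)))
    increasing-chain⇒⋖ {p} {lab} {x} {y} p-atom γp≡1 minimal p⋢x x∨p≡y (cons {z = z} x⋖z c) increasing =
      subst (x ⋖_) z≡y x⋖z
      where
      y-least : ∀ {u} → x ⊑ u → p ⊑ u → y ⊑ u
      y-least {u} x⊑u p⊑u = subst (_⊑ u) x∨p≡y (∨-least x⊑u p⊑u)
      last≤1 : ∀ u → x ⊑ u → u ⋖ y → lab u y ≤ 1
      last≤1 u x⊑u u⋖y = subst (lab u y ≤_) γp≡1 (proj₂ (minimal u y u⋖y) (γ p)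
        (atom-inLabelSet p-atom (subst (p ⊑_) x∨p≡y (y≤x∨y x p)) (λ p⊑u → ⋖-asym u⋖y (y-least x⊑u p⊑u))))
      p⊑z : p ⊑ z
      p⊑z with proj₁ (proj₁ (minimal x z x⋖z))
      ... | a , a-atom , a⊑z , γa≡lab = subst (_⊑ z) (γ-injective a p a-atom p-atom γa≡γp) a⊑z
        where
        γa≡γp : γ a ≡ γ p
        γa≡γp = trans (≤-antisym (subst (_≤ 1) (sym γa≡lab) (first-label-bounded lab last≤1 x⋖z c increasing))
                                 (proj₁ (γ-bounds a a-atom)))
                      (sym γp≡1)
      z≡y : z ≡ y
      z≡y = antisym (satChain⇒⊑ c) (y-least (proj₁ (proj₁ x⋖z)) p⊑z)

  transpose-isAtomBijection : ∀ {n γ i j} → 1 ≤ i × i ≤ n → 1 ≤ j × j ≤ n →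
    IsAtomBijection L n γ → IsAtomBijection L n (transpose i j ∘ γ)
  transpose-isAtomBijection {n} {γ} {i} {j} i∈[n] j∈[n] (γ-bounds , γ-injective , γ-surjective) =
      (λ a a-atom → transpose-preserves InRange i∈[n] j∈[n] (γ-bounds a a-atom))
    , (λ a b a-atom b-atom e → γ-injective a b a-atom b-atom (transpose-injective i j e))
    , surjective
    where
    InRange : Pred ℕ 0ℓ
    InRange v = 1 ≤ v × v ≤ n
    surjective : ∀ k → 1 ≤ k → k ≤ n → Σ[ a ∈ Elem ] (IsAtom a × transpose i j (γ a) ≡ k)
    surjective k 1≤k k≤n with transpose-preserves InRange i∈[n] j∈[n] (1≤k , k≤n)
    ... | 1≤k′ , k′≤n with γ-surjective (transpose i j k) 1≤k′ k′≤n
    ...   | a , a-atom , γa≡k′ = a , a-atom , trans (cong (transpose i j) γa≡k′) (transpose-involutive i j k)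

  atomBijection-sending-to-1 : ∀ {n p} → HasAtomCount L n → IsAtom p →
    Σ[ γ ∈ (Elem → ℕ) ] (IsAtomBijection L n γ × γ p ≡ 1)
  atomBijection-sending-to-1 {n} {p} (γ₀ , bij₀) p-atom =
      transpose (γ₀ p) 1 ∘ γ₀
    , transpose-isAtomBijection (1≤γ₀p , γ₀p≤n) (≤-refl , ≤-trans 1≤γ₀p γ₀p≤n) bij₀
    , transpose-i (γ₀ p) 1
    where
    1≤γ₀p : 1 ≤ γ₀ p
    1≤γ₀p = proj₁ (proj₁ bij₀ p p-atom)
    γ₀p≤n : γ₀ p ≤ n
    γ₀p≤n = proj₂ (proj₁ bij₀ p p-atom)

  minimalLabelingsEL⇒atomCovering : ∀ {n} → IsAtomic L → HasAtomCount L n →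
    (∀ γ → IsAtomBijection L n γ → ∀ lab → IsMinimalLabeling L γ lab → IsELLabeling L lab) →
    AtomCovering
  minimalLabelingsEL⇒atomCovering atomic count EL {p} {x} p-atom p⋢x =
    let γ , bij , γp≡1         = atomBijection-sending-to-1 count p-atom
        minimal                = minimalLabeling-isMinimal bij atomic
        _ , chain , increasing , _ = EL γ bij (minimalLabeling bij) minimal x (x ∨ p) (x≤x∨y x p)
    in increasing-chain⇒⋖ bij p-atom γp≡1 minimal p⋢x refl chain increasing

theorem2 : (L : FiniteLattice) (n : ℕ) →
    IsAtomic L →
    HasAtomCount L n →
    (∀ γ → IsAtomBijection L n γ →
       ∀ lab → IsMinimalLabeling L γ lab → IsELLabeling L lab) →
    IsGeometric L
theorem2 L n atomic count EL =
  atomic , atomic-covering⇒semimodular L atomic (minimalLabelingsEL⇒atomCovering L atomic count EL)
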